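{- Let $\mathbf{C}$ be a presheaf topos and $v:A\to B$ an arrow. 1. For a family $\mathcal{S}$ of maps $\mathcal{S}_Z:\mathbf{C}(A,Z)\to\mathbf{C}(B,Z)$, the following three statements are equivalent: (a) $\mathcal{S}$ is a forward source shifter for $v$; (b) $\mathcal{S}$ is a source shifter from $A$ to $B$ with $\mathcal{S}(v)=\mathit{id}_B$; (c) $s=\mathcal{S}(\mathit{id}_A)$ satisfies $s;v=\mathit{id}_B$, and $\mathcal{S}(a)=s;a$ for all $a:A\to C$. 2. If $\mathcal{S}$ is a source shifter from $B$ to $A$ with $\mathcal{S}(\mathit{id}_B)=v$, then $\mathcal{S}$ is a backward source shifter for $v$ if and only if $v$ is an epimorphism.
   Context: Composition is written in diagrammatic order: $f;g$ is $f$ followed by $g$. $\mathbf{C}(X,Z)$ is the set of arrows from $X$ to $Z$. A source shifter from $X$ to $Y$ is a family of maps $\mathcal{S}_Z:\mathbf{C}(X,Z)\to\mathbf{C}(Y,Z)$ such that $\mathcal{S}(a;t)=\mathcal{S}(a);t$ for all $a:X\to Z$ and $t:Z\to U$. For $v:A\to B$: - A forward source shifter for $v$ is a source shifter $\mathcal{S}$ from $A$ to $B$ such that, for all $a:A\to C$, $g:B\to G$, $h:C\to G$, $v;g=a;h$ implies $g=\mathcal{S}(a);h$. - A backward source shifter for $v$ is a source shifter $\mathcal{S}$ from $B$ to $A$ such that, for all $a:B\to C$, $g:B\to G$, $h:C\to G$, $v;g=\mathcal{S}(a);h$ implies $g=a;h$. -}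

module Defs where

open import Level using (Level; _⊔_; 0ℓ) renaming (suc to lsuc)
open import Data.Product using (_×_; _,_)
open import Relation.Binary.PropositionalEquality as Eq using (_≡_; refl; sym; trans; cong)
open import Relation.Binary.Structures using (IsEquivalence)

_⟺_ : ∀ {a b} → Set a → Set b → Set (a ⊔ b)
P ⟺ Q = (P → Q) × (Q → P)

infix 2 _⟺_

-- Categories (hom-setoids), composition in DIAGRAMMATIC order: f ; g.

record Category (o ℓ e : Level) : Set (lsuc (o ⊔ ℓ ⊔ e)) where
  infixr 9 _⨾_
  infix 4 _≈_
  field
    Obj   : Set o
    Hom   : Obj → Obj → Set ℓ
    _≈_   : ∀ {X Y} → Hom X Y → Hom X Y → Set e
    id    : ∀ {X} → Hom X X
    _⨾_   : ∀ {X Y Z} → Hom X Y → Hom Y Z → Hom X Z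
    ≈-equiv : ∀ {X Y} → IsEquivalence (_≈_ {X} {Y})
    assoc : ∀ {W X Y Z} (f : Hom W X) (g : Hom X Y) (h : Hom Y Z) →
            (f ⨾ g) ⨾ h ≈ f ⨾ (g ⨾ h)
    idˡ   : ∀ {X Y} (f : Hom X Y) → id ⨾ f ≈ f
    idʳ   : ∀ {X Y} (f : Hom X Y) → f ⨾ id ≈ f
    ⨾-resp : ∀ {X Y Z} {f f' : Hom X Y} {g g' : Hom Y Z} →
             f ≈ f' → g ≈ g' → f ⨾ g ≈ f' ⨾ g'

module _ (C : Category 0ℓ 0ℓ 0ℓ) where
  private module C = Category C

  record Presheaf : Set₁ where
    field
      F₀   : C.Obj → Set
      act  : ∀ {X Y} → C.Hom X Y → F₀ Y → F₀ X
      act-id : ∀ {X} (x : F₀ X) → act C.id x ≡ x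
      act-⨾  : ∀ {X Y Z} (f : C.Hom X Y) (g : C.Hom Y Z) (x : F₀ Z) →
               act (f C.⨾ g) x ≡ act f (act g x)
      act-resp : ∀ {X Y} {f f' : C.Hom X Y} → f C.≈ f' → ∀ x → act f x ≡ act f' x
  open Presheaf

  record NatTrans (F G : Presheaf) : Set where
    field
      η   : ∀ X → F₀ F X → F₀ G X
      nat : ∀ {X Y} (f : C.Hom X Y) (x : F₀ F Y) →
            η X (act F f x) ≡ act G f (η Y x)
  open NatTrans

  _≈ₙ_ : ∀ {F G} → NatTrans F G → NatTrans F G → Set
  α ≈ₙ β = ∀ X x → η α X x ≡ η β X x

  idₙ : ∀ {F} → NatTrans F F
  idₙ = record { η = λ _ x → x ; nat = λ _ _ → refl }

  _⨾ₙ_ : ∀ {F G H} → NatTrans F G → NatTrans G H → NatTrans F H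
  _⨾ₙ_ {F} {G} {H} α β = record
    { η = λ X x → η β X (η α X x)
    ; nat = λ f x → trans (cong (η β _) (nat α f x)) (nat β f (η α _ x)) }

  PSh : Category (lsuc 0ℓ) 0ℓ 0ℓ
  PSh = record
    { Obj = Presheaf
    ; Hom = NatTrans
    ; _≈_ = _≈ₙ_
    ; id = idₙ
    ; _⨾_ = _⨾ₙ_
    ; ≈-equiv = record
        { refl = λ _ _ → refl
        ; sym = λ p X x → sym (p X x)
        ; trans = λ p q X x → trans (p X x) (q X x) }
    ; assoc = λ _ _ _ _ _ → refl
    ; idˡ = λ _ _ _ → refl
    ; idʳ = λ _ _ _ → refl
    ; ⨾-resp = λ {_} {_} {_} {f} {f'} {g} {g'} p q X x →
        trans (cong (η g X) (p X x)) (q X (η f' X x)) }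

module Shifters {o ℓ e} (𝐂 : Category o ℓ e) where
  open Category 𝐂

  Family : Obj → Obj → Set (o ⊔ ℓ)
  Family X Y = ∀ {Z} → Hom X Z → Hom Y Z

  -- Each S_Z is a map of hom-sets, i.e. respects equality of arrows.
  IsMapFamily : ∀ {X Y} → Family X Y → Set (o ⊔ ℓ ⊔ e)
  IsMapFamily S = ∀ {Z} {a a' : Hom _ Z} → a ≈ a' → S a ≈ S a'

  IsSourceShifter : ∀ {X Y} → Family X Y → Set (o ⊔ ℓ ⊔ e)
  IsSourceShifter {X} S =
    ∀ {Z U} (a : Hom X Z) (t : Hom Z U) → S (a ⨾ t) ≈ S a ⨾ t

  IsForwardShifter : ∀ {A B} → Hom A B → Family A B → Set (o ⊔ ℓ ⊔ e)
  IsForwardShifter {A} {B} v S =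
    IsSourceShifter S ×
    (∀ {C G} (a : Hom A C) (g : Hom B G) (h : Hom C G) →
       v ⨾ g ≈ a ⨾ h → g ≈ S a ⨾ h)

  IsBackwardShifter : ∀ {A B} → Hom A B → Family B A → Set (o ⊔ ℓ ⊔ e)
  IsBackwardShifter {A} {B} v S =
    IsSourceShifter S ×
    (∀ {C G} (a : Hom B C) (g : Hom B G) (h : Hom C G) →
       v ⨾ g ≈ S a ⨾ h → g ≈ a ⨾ h)

  IsEpi : ∀ {A B} → Hom A B → Set (o ⊔ ℓ ⊔ e)
  IsEpi {A} {B} v = ∀ {Z} (g h : Hom B Z) → v ⨾ g ≈ v ⨾ h → g ≈ h

{-# OPTIONS --safe #-}
module Submission where

open import Defs
open import Data.Product using (_×_; _,_)
open import Level using (0ℓ; Level; _⊔_)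
open import Relation.Binary.Bundles using (Setoid)
open import Relation.Binary.Structures using (IsEquivalence)
import Relation.Binary.Reasoning.Setoid as SetoidReasoning

-- Yoneda: S a ≈ S (id ⨾ a) ≈ S id ⨾ a, so a source shifter is precomposition
-- with s = S id.  For such a family the forward condition at g = h = id says
-- s ⨾ v ≈ S v ≈ id, and conversely g ≈ S v ⨾ g ≈ S (v ⨾ g) ≈ S (a ⨾ h) ≈ S a ⨾ h.
-- When s = v the backward condition with h = id is left cancellation of v, and
-- conversely v ⨾ g ≈ v ⨾ a ⨾ h yields g ≈ a ⨾ h as soon as v is epi.  Nothing
-- about presheaves is used: both parts hold in every category.

module ShifterProperties {o ℓ e : Level} (𝐂 : Category o ℓ e) where
  open Category 𝐂
  open Shifters 𝐂

  hom-setoid : Obj → Obj → Setoid ℓ e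
  hom-setoid X Y = record { Carrier = Hom X Y ; _≈_ = _≈_ ; isEquivalence = ≈-equiv }

  private
    module ≈ {X Y : Obj} = IsEquivalence (≈-equiv {X} {Y})
    open module HomReasoning {X Y : Obj} = SetoidReasoning (hom-setoid X Y)

  ⨾-respˡ : ∀ {X Y Z} {f f' : Hom X Y} (g : Hom Y Z) → f ≈ f' → f ⨾ g ≈ f' ⨾ g
  ⨾-respˡ g f≈f' = ⨾-resp f≈f' ≈.refl

  IsPrecomposition : ∀ {X Y} → Hom Y X → Family X Y → Set (o ⊔ ℓ ⊔ e)
  IsPrecomposition s S = ∀ {Z} (a : Hom _ Z) → S a ≈ s ⨾ a

  sourceShifter⇒precomposition : ∀ {X Y} {S : Family X Y} →
    IsMapFamily S → IsSourceShifter S → IsPrecomposition (S id) S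
  sourceShifter⇒precomposition {S = S} S-resp shift a = begin
    S a        ≈⟨ S-resp (≈.sym (idˡ a)) ⟩
    S (id ⨾ a) ≈⟨ shift id a ⟩
    S id ⨾ a   ∎

  precomposition⇒sourceShifter : ∀ {X Y} {s : Hom Y X} {S : Family X Y} →
    IsPrecomposition s S → IsSourceShifter S
  precomposition⇒sourceShifter {s = s} {S} S≈s⨾ a t = begin
    S (a ⨾ t)   ≈⟨ S≈s⨾ (a ⨾ t) ⟩
    s ⨾ (a ⨾ t) ≈⟨ ≈.sym (assoc s a t) ⟩
    (s ⨾ a) ⨾ t ≈⟨ ⨾-respˡ t (≈.sym (S≈s⨾ a)) ⟩
    S a ⨾ t     ∎

  forwardShifter⇒S[v]≈id : ∀ {A B} {v : Hom A B} {S : Family A B} →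
    IsForwardShifter v S → S v ≈ id
  forwardShifter⇒S[v]≈id {v = v} {S} (_ , forward) = begin
    S v      ≈⟨ idʳ (S v) ⟨
    S v ⨾ id ≈⟨ forward v id id ≈.refl ⟨
    id       ∎

  sourceShifter⇒forwardShifter : ∀ {A B} {v : Hom A B} {S : Family A B} →
    IsMapFamily S → IsSourceShifter S → S v ≈ id → IsForwardShifter v S
  sourceShifter⇒forwardShifter {v = v} {S} S-resp shift S[v]≈id =
    shift , forward
    where
    forward : ∀ {C G} (a : Hom _ C) (g : Hom _ G) (h : Hom C G) →
              v ⨾ g ≈ a ⨾ h → g ≈ S a ⨾ h
    forward a g h v⨾g≈a⨾h = begin
      g         ≈⟨ idˡ g ⟨
      id ⨾ g    ≈⟨ ⨾-respˡ g S[v]≈id ⟨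
      S v ⨾ g   ≈⟨ shift v g ⟨
      S (v ⨾ g) ≈⟨ S-resp v⨾g≈a⨾h ⟩
      S (a ⨾ h) ≈⟨ shift a h ⟩
      S a ⨾ h   ∎

  forward-shifter-characterisation : ∀ {A B : Obj} (v : Hom A B) (S : Family A B) →
    IsMapFamily S →
    ((IsForwardShifter v S ⟺ (IsSourceShifter S × S v ≈ id))
    × ((IsSourceShifter S × S v ≈ id) ⟺
       ((S id ⨾ v ≈ id) × (∀ {C'} (a : Hom A C') → S a ≈ S id ⨾ a))))
  forward-shifter-characterisation v S S-resp =
    ( (λ fwd@(shift , _) → shift , forwardShifter⇒S[v]≈id fwd)
    , (λ (shift , S[v]≈id) → sourceShifter⇒forwardShifter S-resp shift S[v]≈id) )
    , ( (λ (shift , S[v]≈id) →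
          let S≈S[id]⨾ = sourceShifter⇒precomposition S-resp shift
          in ≈.trans (≈.sym (S≈S[id]⨾ v)) S[v]≈id , S≈S[id]⨾)
      , (λ (S[id]⨾v≈id , S≈S[id]⨾) →
          precomposition⇒sourceShifter S≈S[id]⨾ , ≈.trans (S≈S[id]⨾ v) S[id]⨾v≈id) )

  backwardShifter⇒epi : ∀ {A B} {v : Hom A B} {S : Family B A} →
    IsPrecomposition v S → IsBackwardShifter v S → IsEpi v
  backwardShifter⇒epi {v = v} {S} S≈v⨾ (_ , backward) g h v⨾g≈v⨾h = begin
    g      ≈⟨ backward h g id v⨾g≈S[h]⨾id ⟩
    h ⨾ id ≈⟨ idʳ h ⟩
    h      ∎
    where
    v⨾g≈S[h]⨾id : v ⨾ g ≈ S h ⨾ id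
    v⨾g≈S[h]⨾id = begin
      v ⨾ g    ≈⟨ v⨾g≈v⨾h ⟩
      v ⨾ h    ≈⟨ S≈v⨾ h ⟨
      S h      ≈⟨ idʳ (S h) ⟨
      S h ⨾ id ∎

  epi⇒backwardShifter : ∀ {A B} {v : Hom A B} {S : Family B A} →
    IsPrecomposition v S → IsEpi v → IsBackwardShifter v S
  epi⇒backwardShifter {v = v} {S} S≈v⨾ v-epi =
    precomposition⇒sourceShifter S≈v⨾ , backward
    where
    backward : ∀ {C G} (a : Hom _ C) (g : Hom _ G) (h : Hom C G) →
               v ⨾ g ≈ S a ⨾ h → g ≈ a ⨾ h
    backward a g h v⨾g≈S[a]⨾h = v-epi g (a ⨾ h) (begin
      v ⨾ g       ≈⟨ v⨾g≈S[a]⨾h ⟩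
      S a ⨾ h     ≈⟨ ⨾-respˡ h (S≈v⨾ a) ⟩
      (v ⨾ a) ⨾ h ≈⟨ assoc v a h ⟩
      v ⨾ (a ⨾ h) ∎)

  backwardShifter⇔epi : ∀ {A B : Obj} (v : Hom A B) (S : Family B A) →
    IsMapFamily S → IsSourceShifter S → S id ≈ v →
    (IsBackwardShifter v S ⟺ IsEpi v)
  backwardShifter⇔epi v S S-resp shift S[id]≈v =
    backwardShifter⇒epi S≈v⨾ , epi⇒backwardShifter S≈v⨾
    where
    S≈v⨾ : IsPrecomposition v S
    S≈v⨾ a = ≈.trans (sourceShifter⇒precomposition S-resp shift a) (⨾-respˡ a S[id]≈v)

proposition1 : (C : Category 0ℓ 0ℓ 0ℓ) →
    let 𝐏 = PSh C in
    let open Category 𝐏 in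
    let open Shifters 𝐏 in
    (∀ {A B : Obj} (v : Hom A B) (S : Family A B) → IsMapFamily S →
      ((IsForwardShifter v S ⟺ (IsSourceShifter S × S v ≈ id))
      × ((IsSourceShifter S × S v ≈ id) ⟺
          ((S id ⨾ v ≈ id) × (∀ {C'} (a : Hom A C') → S a ≈ S id ⨾ a)))))
    ×
    (∀ {A B : Obj} (v : Hom A B) (S : Family B A) → IsMapFamily S →
      IsSourceShifter S → S id ≈ v →
      (IsBackwardShifter v S ⟺ IsEpi v))
proposition1 C = forward-shifter-characterisation , backwardShifter⇔epi
  where open ShifterProperties (PSh C)
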